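{- For every integer $p\ge1$ and every $\ell\in\{0,1,\dots,p-1\}$, \[ c_{p,\ell}=(p-\ell)!\,S(p,p-\ell), \] where $S(\cdot,\cdot)$ denotes the Stirling numbers of the second kind and $c_{p,\ell}$ is defined below.
   Context: For a finite tuple $(k_1,\dots,k_m)$ of nonnegative integers ($m\ge 0$), its content is $\sum_{i=1}^m k_i$ and its support is the number of indices $i$ with $k_i>0$. For integers $p\ge1$ and $0\le \ell\le p-1$, define \[ c_{p,\ell}=\sum_{(k_1,\dots,k_m)}\frac{p!}{(k_1+1)!(k_2+1)!\cdots(k_m+1)!}, \] where the sum runs over all $m\ge 0$ and all $m$-tuples $(k_1,\dots,k_m)$ of nonnegative integers with content $\ell$ and support $s=m+\ell+1-p$, such that for every $j<m$, $k_j>0$ implies $k_{j+1}=0$ (the empty tuple, when admissible, contributes $p!$). -}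

module Defs where

open import Data.Nat using (ℕ; zero; suc; _+_; _*_; NonZero; _≡ᵇ_)
open import Data.Nat using (_!)
open import Data.Nat.Properties using (_!≢0)
open import Data.Nat.Properties using (m*n≢0)
open import Data.Bool using (Bool; true; false; _∧_; not)
open import Data.List using (List; []; _∷_; map; concatMap; filter; upTo; length; foldr)
open import Data.Nat.ListAction using (sum)
open import Data.Integer using (+_)
open import Data.Rational using (ℚ; _/_; 0ℚ) renaming (_+_ to _+ℚ_)
open import Relation.Nullary.Decidable using (yes; no)
open import Data.Bool using (T?)

S : ℕ → ℕ → ℕ
S zero    zero    = 1
S zero    (suc k) = 0
S (suc n) zero    = 0
S (suc n) (suc k) = suc k * S n (suc k) + S n k

content : List ℕ → ℕ
content = sum

support : List ℕ → ℕ
support []            = 0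
support (zero  ∷ ks)  = support ks
support (suc _ ∷ ks)  = suc (support ks)

noAdjPos : List ℕ → Bool
noAdjPos []                   = true
noAdjPos (_ ∷ [])             = true
noAdjPos (zero  ∷ k ∷ ks)     = noAdjPos (k ∷ ks)
noAdjPos (suc _ ∷ zero ∷ ks)  = noAdjPos (zero ∷ ks)
noAdjPos (suc _ ∷ suc _ ∷ ks) = false

prodFact : List ℕ → ℕ
prodFact []       = 1
prodFact (k ∷ ks) = suc k ! * prodFact ks

prodFact≢0 : (ks : List ℕ) → NonZero (prodFact ks)
prodFact≢0 []       = _
prodFact≢0 (k ∷ ks) = m*n≢0 (suc k !) (prodFact ks) {{suc k !≢0}} {{prodFact≢0 ks}}

tuples : ℕ → ℕ → List (List ℕ)
tuples zero    b = [] ∷ []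
tuples (suc m) b = concatMap (λ k → map (k ∷_) (tuples m b)) (upTo (suc b))

-- admissibility for c_{p,ℓ}: length m, content ℓ, support s with s = m + ℓ + 1 - p
-- (encoded as s + p = m + ℓ + 1, which also requires m + ℓ + 1 ≥ p), and no two
-- consecutive positive entries
admissible : ℕ → ℕ → List ℕ → Bool
admissible p ℓ ks =
  (content ks ≡ᵇ ℓ) ∧ ((support ks + p) ≡ᵇ (length ks + ℓ + 1)) ∧ noAdjPos ks

-- Every admissible tuple has entries ≤ ℓ (content ℓ) and
-- length m ≤ p - 1 (since support ≤ content), so enumerating m ∈ {0,…,p} and
-- entries in {0,…,ℓ} covers every admissible tuple exactly once.
candidates : ℕ → ℕ → List (List ℕ)
candidates p ℓ = concatMap (λ m → tuples m ℓ) (upTo (suc p))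

term : ℕ → List ℕ → ℚ
term p ks = ((+ (p !)) / prodFact ks) {{prodFact≢0 ks}}

sumℚ : List ℚ → ℚ
sumℚ = foldr _+ℚ_ 0ℚ

c : ℕ → ℕ → ℚ
c p ℓ = sumℚ (map (term p) (filter (λ ks → T? (admissible p ℓ ks)) (candidates p ℓ)))

-- Write p = z + ℓ + 1: an admissible tuple has content ℓ and exactly z zero entries, and each
-- positive entry is followed by a zero or ends the tuple. Grouping every positive entry with the
-- zero after it, the tuple is a sequence of z blocks (a lone 0, or k,0 with k ≥ 1), possibly
-- followed by one positive entry. Weighting an entry k by 1/(k+1)! and counting content plus
-- zeros with x, each block contributes x^j/j! (j ≥ 1) and the tail Σₖ xᵏ/(k+1)!, so
-- c_{p,ℓ}/p! = [x^(ℓ+z)] (eˣ−1)^z (eˣ−1)/x = [x^p] (eˣ−1)^(z+1) = (z+1)! S(p,z+1)/p!.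
--
-- Formally, reading a tuple from the left shows that the weighted counts obey
-- a(z,c) = Σ_{i+k=c} ([i = z = 0] + a(z−1,i)) / (k+1)!, the coefficient form of
-- F_z = ((eˣ−1)/x)·([z = 0] + F_{z−1}). The coefficients of ((eˣ−1)/x)^(z+1) satisfy it by the
-- recurrence for surjections that classifies them by the preimage of the last point.

module Submission where

open import Level using (Level)
open import Algebra.Bundles using (CommutativeSemiring; CommutativeRing)
open import Data.Bool using (Bool; true; false; _∧_; if_then_else_; T?)
open import Data.List using (List; []; _∷_; _++_; map; concatMap; filter; foldr; upTo; applyUpTo; length)
open import Data.List.Properties using (map-applyUpTo)
open import Data.Nat as ℕ using (ℕ; zero; suc; _≤_; _<_; z≤n; s≤s)
import Data.Nat.Properties as ℕP
open import Function using (id; _∘_)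
open import Relation.Binary.PropositionalEquality as ≡ using (_≡_)

-- Finite sums over a commutative semiring

module FiniteSums {c ℓ} (R : CommutativeSemiring c ℓ) where

  open CommutativeSemiring R
  open import Relation.Binary.Reasoning.Setoid setoid
  open import Algebra.Properties.CommutativeSemigroup +-commutativeSemigroup using (interchange)

  private
    variable
      a : Level
      A B : Set a

  sumOver : List A → (A → Carrier) → Carrier
  sumOver xs f = foldr _+_ 0# (map f xs)

  syntax sumOver xs (λ x → e) = ∑[ x ∈ xs ] e

  ∑-cong : ∀ (xs : List A) {f g : A → Carrier} → (∀ x → f x ≈ g x) →
           ∑[ x ∈ xs ] f x ≈ ∑[ x ∈ xs ] g x
  ∑-cong []       f≈g = refl
  ∑-cong (x ∷ xs) f≈g = +-cong (f≈g x) (∑-cong xs f≈g)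

  ∑-++ : ∀ (xs ys : List A) (f : A → Carrier) →
         ∑[ x ∈ xs ++ ys ] f x ≈ ∑[ x ∈ xs ] f x + ∑[ y ∈ ys ] f y
  ∑-++ []       ys f = sym (+-identityˡ _)
  ∑-++ (x ∷ xs) ys f = trans (+-congˡ (∑-++ xs ys f)) (sym (+-assoc (f x) _ _))

  ∑-concatMap : ∀ (xs : List A) (g : A → List B) (f : B → Carrier) →
                ∑[ y ∈ concatMap g xs ] f y ≈ ∑[ x ∈ xs ] ∑[ y ∈ g x ] f y
  ∑-concatMap []       g f = refl
  ∑-concatMap (x ∷ xs) g f = trans (∑-++ (g x) (concatMap g xs) f) (+-congˡ (∑-concatMap xs g f))

  ∑-map : ∀ (xs : List A) (g : A → B) (f : B → Carrier) →
          ∑[ y ∈ map g xs ] f y ≈ ∑[ x ∈ xs ] f (g x)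
  ∑-map []       g f = refl
  ∑-map (x ∷ xs) g f = +-congˡ (∑-map xs g f)

  ∑-zero : ∀ (xs : List A) → ∑[ x ∈ xs ] 0# ≈ 0#
  ∑-zero []       = refl
  ∑-zero (x ∷ xs) = trans (+-identityˡ _) (∑-zero xs)

  ∑-*ˡ : ∀ (xs : List A) (a : Carrier) (f : A → Carrier) →
         ∑[ x ∈ xs ] (a * f x) ≈ a * ∑[ x ∈ xs ] f x
  ∑-*ˡ []       a f = sym (zeroʳ a)
  ∑-*ˡ (x ∷ xs) a f = trans (+-congˡ (∑-*ˡ xs a f)) (sym (distribˡ a (f x) _))

  ∑-+ : ∀ (xs : List A) (f g : A → Carrier) →
        ∑[ x ∈ xs ] (f x + g x) ≈ ∑[ x ∈ xs ] f x + ∑[ x ∈ xs ] g x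
  ∑-+ []       f g = sym (+-identityˡ 0#)
  ∑-+ (x ∷ xs) f g = trans (+-congˡ (∑-+ xs f g)) (interchange (f x) (g x) _ _)

  ∑-comm : ∀ (xs : List A) (ys : List B) (f : A → B → Carrier) →
           ∑[ x ∈ xs ] ∑[ y ∈ ys ] f x y ≈ ∑[ y ∈ ys ] ∑[ x ∈ xs ] f x y
  ∑-comm []       ys f = sym (∑-zero ys)
  ∑-comm (x ∷ xs) ys f = trans (+-congˡ (∑-comm xs ys f)) (sym (∑-+ ys (f x) _))

  ∑-filter : ∀ (xs : List A) (P : A → Bool) (f : A → Carrier) →
             ∑[ x ∈ filter (T? ∘ P) xs ] f x ≈ ∑[ x ∈ xs ] (if P x then f x else 0#)
  ∑-filter []       P f = refl
  ∑-filter (x ∷ xs) P f with P x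
  ... | true  = +-congˡ (∑-filter xs P f)
  ... | false = trans (∑-filter xs P f) (sym (+-identityˡ _))

  ∑-upTo-suc : ∀ n (f : ℕ → Carrier) →
               ∑[ i ∈ upTo (suc n) ] f i ≈ f 0 + ∑[ i ∈ upTo n ] f (suc i)
  ∑-upTo-suc n f = +-congˡ (begin
    ∑[ i ∈ applyUpTo suc n ] f i    ≡⟨ ≡.cong (λ is → ∑[ i ∈ is ] f i) (map-applyUpTo id suc n) ⟨
    ∑[ i ∈ map suc (upTo n) ] f i   ≈⟨ ∑-map (upTo n) suc f ⟩
    ∑[ i ∈ upTo n ] f (suc i)       ∎)

  atRemainder : ℕ → ℕ → (ℕ → Carrier) → Carrier
  atRemainder n       zero    f = f n
  atRemainder zero    (suc k) f = 0#
  atRemainder (suc n) (suc k) f = atRemainder n k f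

  atRemainder-cong : ∀ n k {f g : ℕ → Carrier} → (∀ i → i ℕ.+ k ≡ n → f i ≈ g i) →
                     atRemainder n k f ≈ atRemainder n k g
  atRemainder-cong n       zero    f≈g = f≈g n (ℕP.+-identityʳ n)
  atRemainder-cong zero    (suc k) f≈g = refl
  atRemainder-cong (suc n) (suc k) f≈g =
    atRemainder-cong n k (λ i i+k≡n → f≈g i (≡.trans (ℕP.+-suc i k) (≡.cong suc i+k≡n)))

  atRemainder-*ˡ : ∀ n k (a : Carrier) (f : ℕ → Carrier) →
                   atRemainder n k (λ i → a * f i) ≈ a * atRemainder n k f
  atRemainder-*ˡ n       zero    a f = refl
  atRemainder-*ˡ zero    (suc k) a f = sym (zeroʳ a)
  atRemainder-*ˡ (suc n) (suc k) a f = atRemainder-*ˡ n k a f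

  ∑-atRemainder : ∀ (xs : List A) n k (f : ℕ → A → Carrier) →
                  ∑[ x ∈ xs ] atRemainder n k (λ i → f i x) ≈ atRemainder n k (λ i → ∑[ x ∈ xs ] f i x)
  ∑-atRemainder xs n       zero    f = refl
  ∑-atRemainder xs zero    (suc k) f = ∑-zero xs
  ∑-atRemainder xs (suc n) (suc k) f = ∑-atRemainder xs n k f

  antidiagonal : ℕ → (ℕ → ℕ → Carrier) → Carrier
  antidiagonal zero    f = f 0 0
  antidiagonal (suc n) f = f (suc n) 0 + antidiagonal n (λ i k → f i (suc k))

  antidiagonal-cong : ∀ n {f g : ℕ → ℕ → Carrier} → (∀ i k → i ℕ.+ k ≡ n → f i k ≈ g i k) →
                      antidiagonal n f ≈ antidiagonal n g
  antidiagonal-cong zero    f≈g = f≈g 0 0 ≡.refl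
  antidiagonal-cong (suc n) f≈g = +-cong (f≈g (suc n) 0 (≡.cong suc (ℕP.+-identityʳ n)))
    (antidiagonal-cong n (λ i k i+k≡n → f≈g i (suc k) (≡.trans (ℕP.+-suc i k) (≡.cong suc i+k≡n))))

  antidiagonal-zero : ∀ n → antidiagonal n (λ _ _ → 0#) ≈ 0#
  antidiagonal-zero zero    = refl
  antidiagonal-zero (suc n) = trans (+-identityˡ _) (antidiagonal-zero n)

  antidiagonal-+ : ∀ n (f g : ℕ → ℕ → Carrier) →
                   antidiagonal n (λ i k → f i k + g i k) ≈ antidiagonal n f + antidiagonal n g
  antidiagonal-+ zero    f g = refl
  antidiagonal-+ (suc n) f g = trans (+-congˡ (antidiagonal-+ n _ _)) (interchange (f (suc n) 0) (g (suc n) 0) _ _)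

  antidiagonal-*ˡ : ∀ n (a : Carrier) (f : ℕ → ℕ → Carrier) →
                    antidiagonal n (λ i k → a * f i k) ≈ a * antidiagonal n f
  antidiagonal-*ˡ zero    a f = refl
  antidiagonal-*ˡ (suc n) a f = trans (+-congˡ (antidiagonal-*ˡ n a _)) (sym (distribˡ a _ _))

  antidiagonal-last : ∀ n (f : ℕ → ℕ → Carrier) →
                      antidiagonal (suc n) f ≈ antidiagonal n (λ i k → f (suc i) k) + f 0 (suc n)
  antidiagonal-last zero    f = refl
  antidiagonal-last (suc n) f =
    trans (+-congˡ (antidiagonal-last n (λ i k → f i (suc k)))) (sym (+-assoc (f (suc (suc n)) 0) _ _))

  antidiagonal-shift : ∀ d n (f : ℕ → ℕ → Carrier) → (∀ i k → i < d → f i k ≈ 0#) →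
                       antidiagonal (d ℕ.+ n) f ≈ antidiagonal n (λ i k → f (d ℕ.+ i) k)
  antidiagonal-shift zero    n f f≈0 = refl
  antidiagonal-shift (suc d) n f f≈0 = begin
    antidiagonal (suc (d ℕ.+ n)) f
      ≈⟨ antidiagonal-last (d ℕ.+ n) f ⟩
    antidiagonal (d ℕ.+ n) (λ i k → f (suc i) k) + f 0 (suc (d ℕ.+ n))
      ≈⟨ +-cong (antidiagonal-shift d n _ (λ i k i<d → f≈0 (suc i) k (s≤s i<d))) (f≈0 0 _ (s≤s z≤n)) ⟩
    antidiagonal n (λ i k → f (suc d ℕ.+ i) k) + 0#
      ≈⟨ +-identityʳ _ ⟩
    antidiagonal n (λ i k → f (suc d ℕ.+ i) k) ∎

  atRemainder-sum≈antidiagonal : ∀ n b (f : ℕ → ℕ → Carrier) → n ≤ b →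
    f n 0 + ∑[ j ∈ upTo b ] atRemainder n (suc j) (λ i → f i (suc j)) ≈ antidiagonal n f
  atRemainder-sum≈antidiagonal zero    b       f _         = trans (+-congˡ (∑-zero (upTo b))) (+-identityʳ _)
  atRemainder-sum≈antidiagonal (suc n) (suc b) f (s≤s n≤b) = +-congˡ (begin
    ∑[ j ∈ upTo (suc b) ] atRemainder (suc n) (suc j) (λ i → f i (suc j))
      ≈⟨ ∑-upTo-suc b _ ⟩
    f n 1 + ∑[ j ∈ upTo b ] atRemainder n (suc j) (λ i → f i (suc (suc j)))
      ≈⟨ atRemainder-sum≈antidiagonal n b (λ i k → f i (suc k)) n≤b ⟩
    antidiagonal n (λ i k → f i (suc k)) ∎)

open import Data.Bool.Properties using (∧-zeroʳ)
open import Data.Product using (_×_; _,_; proj₁; proj₂)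
open import Data.Nat using (_+_; _*_; _∸_; _!; _≡ᵇ_; NonZero)
open import Data.Nat.Properties using (_!≢0; _!*_!≢0; m*n≢0)
open import Data.Nat.Combinatorics using (_C_; nCk≡n!/k![n-k]!; k![n∸k]!∣n!; k>n⇒nCk≡0; nCk+nC[k+1]≡[n+1]C[k+1])
open import Data.Nat.DivMod using (m/n*n≡m)
open import Data.Nat.Tactic.RingSolver using (solve-∀)
open import Data.Integer as ℤ using (+_)
import Data.Integer.Properties as ℤP
open import Data.Rational as ℚ using (ℚ; _/_; 0ℚ; 1ℚ; toℚᵘ)
import Data.Rational.Properties as ℚP
open import Data.Rational.Unnormalised as ℚᵘ using (mkℚᵘ; *≡*)
import Data.Rational.Unnormalised.Properties as ℚᵘP
open import Relation.Binary.PropositionalEquality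
open import Defs

-- Surjection numbers

module ℕΣ = FiniteSums ℕP.+-*-commutativeSemiring

choose-factorial : ∀ m n → ((m + n) C m) * (m ! * n !) ≡ (m + n) !
choose-factorial m n = begin
  ((m + n) C m) * (m ! * n !)
    ≡⟨ cong (λ t → ((m + n) C m) * (m ! * t !)) (ℕP.m+n∸m≡n m n) ⟨
  ((m + n) C m) * (m ! * (m + n ∸ m) !)
    ≡⟨ cong (_* (m ! * (m + n ∸ m) !)) (nCk≡n!/k![n-k]! (ℕP.m≤m+n m n)) ⟩
  (m + n) ! ℕ./ (m ! * (m + n ∸ m) !) * (m ! * (m + n ∸ m) !)
    ≡⟨ m/n*n≡m (k![n∸k]!∣n! (ℕP.m≤m+n m n)) ⟩
  (m + n) ! ∎
  where
  open ≡-Reasoning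
  instance _ = m !* (m + n ∸ m) !≢0

S-< : ∀ {N n} → N < n → S N n ≡ 0
S-< {zero}  {suc n} _         = refl
S-< {suc N} {suc n} (s≤s N<n) =
  trans (cong₂ (λ x y → suc n * x + y) (S-< (ℕP.m<n⇒m<1+n N<n)) (S-< N<n)) (cong (_+ 0) (ℕP.*-zeroʳ (suc n)))

S-1 : ∀ N → S (suc N) 1 ≡ 1
S-1 zero    = refl
S-1 (suc N) = cong (λ x → 1 * x + 0) (S-1 N)

surj : ℕ → ℕ → ℕ
surj N n = n ! * S N n

surj-< : ∀ {N n} → N < n → surj N n ≡ 0
surj-< {N} {n} N<n = trans (cong (n ! *_) (S-< N<n)) (ℕP.*-zeroʳ (n !))

surj-suc : ∀ N n → surj (suc N) (suc n) ≡ suc n * (surj N (suc n) + surj N n)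
surj-suc N n = regroup (suc n) (n !) (S N (suc n)) (S N n)
  where
  regroup : ∀ s f x y → s * f * (s * x + y) ≡ s * (s * f * x + f * y)
  regroup = solve-∀

lastBlock : ℕ → (ℕ → ℕ) → ℕ
lastBlock M f = ℕΣ.antidiagonal M (λ i k → (suc M C suc k) * f i)

lastBlock-linear : ∀ M a (f g : ℕ → ℕ) →
                   lastBlock M (λ i → a * (f i + g i)) ≡ a * (lastBlock M f + lastBlock M g)
lastBlock-linear M a f g = begin
  ℕΣ.antidiagonal M (λ i k → binom k * (a * (f i + g i)))
    ≡⟨ ℕΣ.antidiagonal-cong M (λ i k _ → distribute (binom k) a (f i) (g i)) ⟩
  ℕΣ.antidiagonal M (λ i k → a * (binom k * f i + binom k * g i))
    ≡⟨ ℕΣ.antidiagonal-*ˡ M a (λ i k → binom k * f i + binom k * g i) ⟩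
  a * ℕΣ.antidiagonal M (λ i k → binom k * f i + binom k * g i)
    ≡⟨ cong (a *_) (ℕΣ.antidiagonal-+ M (λ i k → binom k * f i) (λ i k → binom k * g i)) ⟩
  a * (lastBlock M f + lastBlock M g) ∎
  where
  open ≡-Reasoning
  binom : ℕ → ℕ
  binom k = suc M C suc k
  distribute : ∀ c a x y → c * (a * (x + y)) ≡ a * (c * x + c * y)
  distribute = solve-∀

-- Classifying the surjections [M+1] → [n+1] by the preimage (of size k+1) of the last point.
surj-lastBlock : ∀ M n → surj (suc M) (suc n) ≡ lastBlock M (λ i → surj i n)
surj-lastBlock zero    zero    = refl
surj-lastBlock zero    (suc n) =
  trans (surj-< {1} {suc (suc n)} (s≤s (s≤s z≤n)))
        (sym (trans (ℕP.+-identityʳ _) (surj-< {0} {suc n} (s≤s z≤n))))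
surj-lastBlock (suc M) n = sym (begin
  ℕΣ.antidiagonal (suc M) (λ i k → (suc (suc M) C suc k) * surj i n)
    ≡⟨ ℕΣ.antidiagonal-cong (suc M) (λ i k _ → pascal i k) ⟩
  ℕΣ.antidiagonal (suc M) (λ i k → (suc M C k) * surj i n + (suc M C suc k) * surj i n)
    ≡⟨ ℕΣ.antidiagonal-+ (suc M) (λ i k → (suc M C k) * surj i n) (λ i k → (suc M C suc k) * surj i n) ⟩
  (1 * X + lastBlock M (λ i → surj i n)) + ℕΣ.antidiagonal (suc M) (λ i k → (suc M C suc k) * surj i n)
    ≡⟨ cong₂ (λ u v → (1 * X + u) + v) (sym (surj-lastBlock M n))
                                        (ℕΣ.antidiagonal-last M (λ i k → (suc M C suc k) * surj i n)) ⟩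
  (1 * X + Y) + (lastBlock M (λ i → surj (suc i) n) + (suc M C suc (suc M)) * surj 0 n)
    ≡⟨ cong₂ (λ u v → (1 * X + Y) + (u + v * surj 0 n)) (interior n) (k>n⇒nCk≡0 (ℕP.n<1+n (suc M))) ⟩
  (1 * X + Y) + (n * (Y + X) + 0)
    ≡⟨ collect X Y n ⟩
  suc n * (Y + X)
    ≡⟨ surj-suc (suc M) n ⟨
  surj (suc (suc M)) (suc n) ∎)
  where
  open ≡-Reasoning
  X = surj (suc M) n
  Y = surj (suc M) (suc n)
  pascal : ∀ i k → (suc (suc M) C suc k) * surj i n ≡ (suc M C k) * surj i n + (suc M C suc k) * surj i n
  pascal i k = trans (cong (_* surj i n) (sym (nCk+nC[k+1]≡[n+1]C[k+1] (suc M) k)))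
                     (ℕP.*-distribʳ-+ (surj i n) (suc M C k) (suc M C suc k))
  interior : ∀ n → lastBlock M (λ i → surj (suc i) n) ≡ n * (surj (suc M) (suc n) + surj (suc M) n)
  interior zero     =
    trans (ℕΣ.antidiagonal-cong M (λ i k _ → ℕP.*-zeroʳ (suc M C suc k))) (ℕΣ.antidiagonal-zero M)
  interior (suc n′) = begin
    lastBlock M (λ i → surj (suc i) (suc n′))
      ≡⟨ ℕΣ.antidiagonal-cong M (λ i k _ → cong ((suc M C suc k) *_) (surj-suc i n′)) ⟩
    lastBlock M (λ i → suc n′ * (surj i (suc n′) + surj i n′))
      ≡⟨ lastBlock-linear M (suc n′) (λ i → surj i (suc n′)) (λ i → surj i n′) ⟩
    suc n′ * (lastBlock M (λ i → surj i (suc n′)) + lastBlock M (λ i → surj i n′))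
      ≡⟨ cong₂ (λ u v → suc n′ * (u + v)) (surj-lastBlock M (suc n′)) (surj-lastBlock M n′) ⟨
    suc n′ * (surj (suc M) (suc (suc n′)) + surj (suc M) (suc n′)) ∎
  collect : ∀ x y n → (1 * x + y) + (n * (y + x) + 0) ≡ suc n * (y + x)
  collect = solve-∀

infixl 7.5 _÷_ _÷!_

_÷_ : ℕ → (d : ℕ) .{{_ : NonZero d}} → ℚ
a ÷ d = + a / d

toℚᵘ-÷ : ∀ a d → toℚᵘ (a ÷ suc d) ℚᵘ.≃ mkℚᵘ (+ a) d
toℚᵘ-÷ a d = ℚP.toℚᵘ-fromℚᵘ (mkℚᵘ (+ a) d)

÷-cong : ∀ {a b c d} .{{_ : NonZero b}} .{{_ : NonZero d}} → a ≡ c → b ≡ d → a ÷ b ≡ c ÷ d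
÷-cong a≡c b≡d = ℚP./-cong (cong +_ a≡c) b≡d

÷-cross : ∀ a b c d .{{_ : NonZero b}} .{{_ : NonZero d}} → a * d ≡ c * b → a ÷ b ≡ c ÷ d
÷-cross a (suc b) c (suc d) ad≡cb = ℚP.toℚᵘ-injective (begin
  toℚᵘ (a ÷ suc b)   ≈⟨ toℚᵘ-÷ a b ⟩
  mkℚᵘ (+ a) b       ≈⟨ *≡* (trans (sym (ℤP.pos-* a (suc d)))
                                   (trans (cong +_ ad≡cb) (ℤP.pos-* c (suc b)))) ⟩
  mkℚᵘ (+ c) d       ≈⟨ toℚᵘ-÷ c d ⟨
  toℚᵘ (c ÷ suc d)   ∎)
  where open ℚᵘP.≃-Reasoning

÷-*-÷ : ∀ a b c d .{{_ : NonZero b}} .{{_ : NonZero d}} →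
        a ÷ b ℚ.* c ÷ d ≡ ((a * c) ÷ (b * d)) {{m*n≢0 b d}}
÷-*-÷ a (suc b) c (suc d) = ℚP.toℚᵘ-injective (begin
  toℚᵘ (a ÷ suc b ℚ.* c ÷ suc d)            ≈⟨ ℚP.toℚᵘ-homo-* (a ÷ suc b) (c ÷ suc d) ⟩
  toℚᵘ (a ÷ suc b) ℚᵘ.* toℚᵘ (c ÷ suc d)    ≈⟨ ℚᵘP.*-cong (toℚᵘ-÷ a b) (toℚᵘ-÷ c d) ⟩
  mkℚᵘ (+ a) b ℚᵘ.* mkℚᵘ (+ c) d            ≡⟨ cong (λ n → mkℚᵘ n _) (sym (ℤP.pos-* a c)) ⟩
  mkℚᵘ (+ (a * c)) _                         ≈⟨ toℚᵘ-÷ (a * c) _ ⟨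
  toℚᵘ ((a * c) ÷ (suc b * suc d))           ∎)
  where open ℚᵘP.≃-Reasoning

÷-+-÷ : ∀ a b c d .{{_ : NonZero b}} .{{_ : NonZero d}} →
        a ÷ b ℚ.+ c ÷ d ≡ ((a * d + c * b) ÷ (b * d)) {{m*n≢0 b d}}
÷-+-÷ a (suc b) c (suc d) = ℚP.toℚᵘ-injective (begin
  toℚᵘ (a ÷ suc b ℚ.+ c ÷ suc d)                     ≈⟨ ℚP.toℚᵘ-homo-+ (a ÷ suc b) (c ÷ suc d) ⟩
  toℚᵘ (a ÷ suc b) ℚᵘ.+ toℚᵘ (c ÷ suc d)             ≈⟨ ℚᵘP.+-cong (toℚᵘ-÷ a b) (toℚᵘ-÷ c d) ⟩
  mkℚᵘ (+ a) b ℚᵘ.+ mkℚᵘ (+ c) d                     ≡⟨ cong (λ n → mkℚᵘ n _) numerator ⟩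
  mkℚᵘ (+ (a * suc d + c * suc b)) _                  ≈⟨ toℚᵘ-÷ (a * suc d + c * suc b) _ ⟨
  toℚᵘ ((a * suc d + c * suc b) ÷ (suc b * suc d))    ∎)
  where
  open ℚᵘP.≃-Reasoning
  numerator : + a ℤ.* + suc d ℤ.+ + c ℤ.* + suc b ≡ + (a * suc d + c * suc b)
  numerator = trans (cong₂ ℤ._+_ (sym (ℤP.pos-* a (suc d))) (sym (ℤP.pos-* c (suc b))))
                    (sym (ℤP.pos-+ (a * suc d) (c * suc b)))

÷-distribʳ-+ : ∀ a c d .{{_ : NonZero d}} → (a + c) ÷ d ≡ a ÷ d ℚ.+ c ÷ d
÷-distribʳ-+ a c d = sym (trans (÷-+-÷ a d c d) (÷-cross (a * d + c * d) (d * d) (a + c) d {{m*n≢0 d d}} (begin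
  (a * d + c * d) * d   ≡⟨ cong (_* d) (ℕP.*-distribʳ-+ d a c) ⟨
  (a + c) * d * d       ≡⟨ ℕP.*-assoc (a + c) d d ⟩
  (a + c) * (d * d)     ∎)))
  where open ≡-Reasoning

_÷!_ : ℕ → ℕ → ℚ
a ÷! n = (a ÷ n !) {{n !≢0}}

÷!-*-÷! : ∀ a b m n → a ÷! m ℚ.* b ÷! n ≡ (((m + n) C m) * (a * b)) ÷! (m + n)
÷!-*-÷! a b m n = trans (÷-*-÷ a (m !) b (n !) {{m !≢0}} {{n !≢0}})
  (÷-cross (a * b) (m ! * n !) (((m + n) C m) * (a * b)) ((m + n) !) {{m !* n !≢0}} {{(m + n) !≢0}} (begin
    a * b * (m + n) !                          ≡⟨ cong (a * b *_) (choose-factorial m n) ⟨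
    a * b * (((m + n) C m) * (m ! * n !))      ≡⟨ regroup (a * b) ((m + n) C m) (m ! * n !) ⟩
    ((m + n) C m) * (a * b) * (m ! * n !)      ∎))
  where
  open ≡-Reasoning
  regroup : ∀ x y z → x * (y * z) ≡ y * x * z
  regroup = solve-∀

-- Coefficients of powers of (eˣ − 1)/x

open FiniteSums (CommutativeRing.commutativeSemiring ℚP.+-*-commutativeRing)

antidiagonal-÷! : ∀ n (h : ℕ → ℕ → ℕ) D →
                  antidiagonal n (λ i k → h i k ÷! D) ≡ ℕΣ.antidiagonal n h ÷! D
antidiagonal-÷! zero    h D = refl
antidiagonal-÷! (suc n) h D = trans (cong (h (suc n) 0 ÷! D ℚ.+_) (antidiagonal-÷! n (λ i k → h i (suc k)) D))
                                    (sym (÷-distribʳ-+ (h (suc n) 0) _ (D !) {{D !≢0}}))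

-- 1/[1+ k ]! is the coefficient of xᵏ in (eˣ − 1)/x, and expCoeff z c that of xᶜ in ((eˣ − 1)/x)^(z+1).
1/[1+_]! : ℕ → ℚ
1/[1+ k ]! = 1 ÷! suc k

expCoeff : ℕ → ℕ → ℚ
expCoeff z c = surj (suc z + c) (suc z) ÷! (suc z + c)

expCoeff-zero : ∀ c → expCoeff 0 c ≡ 1/[1+ c ]!
expCoeff-zero c = cong (λ s → (1 * s) ÷! suc c) (S-1 c)

expCoeff-suc : ∀ z c → antidiagonal c (λ i k → 1/[1+ k ]! ℚ.* expCoeff z i) ≡ expCoeff (suc z) c
expCoeff-suc z c = begin
  antidiagonal c (λ i k → 1/[1+ k ]! ℚ.* expCoeff z i)
    ≡⟨ antidiagonal-cong c summand ⟩
  antidiagonal c (λ i k → ((N C suc k) * surj (suc z + i) (suc z)) ÷! N)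
    ≡⟨ antidiagonal-÷! c (λ i k → (N C suc k) * surj (suc z + i) (suc z)) N ⟩
  ℕΣ.antidiagonal c (λ i k → (N C suc k) * surj (suc z + i) (suc z)) ÷! N
    ≡⟨ cong (_÷! N) shifted ⟨
  surj N (suc (suc z)) ÷! N ∎
  where
  open ≡-Reasoning
  N = suc (suc z + c)
  summand : ∀ i k → i + k ≡ c → 1/[1+ k ]! ℚ.* expCoeff z i ≡ ((N C suc k) * surj (suc z + i) (suc z)) ÷! N
  summand i k i+k≡c = trans (÷!-*-÷! 1 (surj (suc z + i) (suc z)) (suc k) (suc z + i))
                            (cong₂ (λ n s → ((n C suc k) * s) ÷! n) index (ℕP.*-identityˡ _))
    where
    index : suc k + (suc z + i) ≡ N
    index = cong suc (trans (ℕP.+-comm k (suc z + i))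
                            (trans (ℕP.+-assoc (suc z) i k) (cong (λ t → suc z + t) i+k≡c)))
  shifted : surj N (suc (suc z)) ≡ ℕΣ.antidiagonal c (λ i k → (N C suc k) * surj (suc z + i) (suc z))
  shifted = trans (surj-lastBlock (suc z + c) (suc z)) (ℕΣ.antidiagonal-shift (suc z) c _
    (λ i k i<1+z → trans (cong ((N C suc k) *_) (surj-< i<1+z)) (ℕP.*-zeroʳ (N C suc k))))

δ : ℕ → ℕ → ℚ
δ _       (suc _) = 0ℚ
δ zero    zero    = 1ℚ
δ (suc _) zero    = 0ℚ

antidiagonal-δ : ∀ n (f : ℕ → ℚ) → antidiagonal n (λ i k → f k ℚ.* (δ i 0 ℚ.+ 0ℚ)) ≡ f n
antidiagonal-δ zero    f = ℚP.*-identityʳ (f 0)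
antidiagonal-δ (suc n) f = begin
  f 0 ℚ.* 0ℚ ℚ.+ antidiagonal n (λ i k → f (suc k) ℚ.* (δ i 0 ℚ.+ 0ℚ))
    ≡⟨ cong₂ ℚ._+_ (ℚP.*-zeroʳ (f 0)) (antidiagonal-δ n (f ∘ suc)) ⟩
  0ℚ ℚ.+ f (suc n)
    ≡⟨ ℚP.+-identityˡ (f (suc n)) ⟩
  f (suc n) ∎
  where open ≡-Reasoning

expCoeff⁺ : ℕ → ℕ → ℚ
expCoeff⁺ z c = δ c z ℚ.+ atRemainder z 1 (λ z′ → expCoeff z′ c)

expCoeff-convolution : ∀ z c → antidiagonal c (λ i k → 1/[1+ k ]! ℚ.* expCoeff⁺ z i) ≡ expCoeff z c
expCoeff-convolution zero     c = trans (antidiagonal-δ c 1/[1+_]!) (sym (expCoeff-zero c))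
expCoeff-convolution (suc z′) c = trans
  (antidiagonal-cong c (λ i k _ → cong (1/[1+ k ]! ℚ.*_) (ℚP.+-identityˡ (expCoeff z′ i))))
  (expCoeff-suc z′ c)

-- Admissible tuples with a given content and number of zeros

1/prodFact : List ℕ → ℚ
1/prodFact []       = 1ℚ
1/prodFact (k ∷ ks) = 1/[1+ k ]! ℚ.* 1/prodFact ks

1/prodFact≡ : ∀ ks → 1/prodFact ks ≡ (1 ÷ prodFact ks) {{prodFact≢0 ks}}
1/prodFact≡ []       = refl
1/prodFact≡ (k ∷ ks) = trans (cong (1/[1+ k ]! ℚ.*_) (1/prodFact≡ ks))
                             (÷-*-÷ 1 (suc k !) 1 (prodFact ks) {{suc k !≢0}} {{prodFact≢0 ks}})

term≡ : ∀ p ks → term p ks ≡ p ! ÷ 1 ℚ.* 1/prodFact ks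
term≡ p ks = sym (begin
  p ! ÷ 1 ℚ.* 1/prodFact ks                ≡⟨ cong (p ! ÷ 1 ℚ.*_) (1/prodFact≡ ks) ⟩
  p ! ÷ 1 ℚ.* (1 ÷ prodFact ks) {{P≢0}}    ≡⟨ ÷-*-÷ (p !) 1 1 (prodFact ks) {{_}} {{P≢0}} ⟩
  ((p ! * 1) ÷ (1 * prodFact ks)) {{1P≢0}}
    ≡⟨ ÷-cong {{1P≢0}} {{P≢0}} (ℕP.*-identityʳ (p !)) (ℕP.*-identityˡ (prodFact ks)) ⟩
  term p ks                                ∎)
  where
  open ≡-Reasoning
  P≢0  = prodFact≢0 ks
  1P≢0 = m*n≢0 1 (prodFact ks) {{_}} {{P≢0}}

admissibleByZeros : ℕ → ℕ → List ℕ → Bool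
admissibleByZeros c z ks = (content ks ≡ᵇ c) ∧ ((support ks + z ≡ᵇ length ks) ∧ noAdjPos ks)

≡ᵇ-cancelˡ : ∀ k m n → (k + m ≡ᵇ k + n) ≡ (m ≡ᵇ n)
≡ᵇ-cancelˡ zero    m n = refl
≡ᵇ-cancelˡ (suc k) m n = ≡ᵇ-cancelˡ k m n

<⇒≡ᵇ-false : ∀ {m n} → m < n → (m ≡ᵇ n) ≡ false
<⇒≡ᵇ-false {zero}  {suc n} _         = refl
<⇒≡ᵇ-false {suc m} {suc n} (s≤s m<n) = <⇒≡ᵇ-false m<n

admissible≡admissibleByZeros : ∀ z ℓ ks → admissible (suc z + ℓ) ℓ ks ≡ admissibleByZeros ℓ z ks
admissible≡admissibleByZeros z ℓ ks = cong (λ b → (content ks ≡ᵇ ℓ) ∧ (b ∧ noAdjPos ks)) (begin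
  (support ks + (suc z + ℓ) ≡ᵇ length ks + ℓ + 1)
    ≡⟨ cong₂ _≡ᵇ_ (lhs (support ks) z ℓ) (rhs (length ks) ℓ) ⟩
  (suc ℓ + (support ks + z) ≡ᵇ suc ℓ + length ks)
    ≡⟨ ≡ᵇ-cancelˡ (suc ℓ) (support ks + z) (length ks) ⟩
  (support ks + z ≡ᵇ length ks) ∎)
  where
  open ≡-Reasoning
  lhs : ∀ s z ℓ → s + (suc z + ℓ) ≡ suc ℓ + (s + z)
  lhs = solve-∀
  rhs : ∀ n ℓ → n + ℓ + 1 ≡ suc ℓ + n
  rhs = solve-∀

support≤length : ∀ ks → support ks ≤ length ks
support≤length []           = z≤n
support≤length (zero  ∷ ks) = ℕP.m≤n⇒m≤1+n (support≤length ks)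
support≤length (suc _ ∷ ks) = s≤s (support≤length ks)

noAdjPos-zero∷ : ∀ ks → noAdjPos (zero ∷ ks) ≡ noAdjPos ks
noAdjPos-zero∷ []       = refl
noAdjPos-zero∷ (_ ∷ ks) = refl

noAdjPos-suc∷ : ∀ j ks → noAdjPos (suc j ∷ ks) ≡ noAdjPos (1 ∷ ks)
noAdjPos-suc∷ j []           = refl
noAdjPos-suc∷ j (zero  ∷ ks) = refl
noAdjPos-suc∷ j (suc _ ∷ ks) = refl

admissibleByZeros-zero∷-none : ∀ c ks → admissibleByZeros c 0 (zero ∷ ks) ≡ false
admissibleByZeros-zero∷-none c ks = begin
  A ∧ ((support ks + 0 ≡ᵇ suc (length ks)) ∧ noAdjPos (zero ∷ ks))
    ≡⟨ cong (λ n → A ∧ ((n ≡ᵇ suc (length ks)) ∧ noAdjPos (zero ∷ ks))) (ℕP.+-identityʳ (support ks)) ⟩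
  A ∧ ((support ks ≡ᵇ suc (length ks)) ∧ noAdjPos (zero ∷ ks))
    ≡⟨ cong (λ b → A ∧ (b ∧ noAdjPos (zero ∷ ks))) (<⇒≡ᵇ-false (s≤s (support≤length ks))) ⟩
  A ∧ false
    ≡⟨ ∧-zeroʳ A ⟩
  false ∎
  where
  open ≡-Reasoning
  A = content ks ≡ᵇ c

admissibleByZeros-zero∷ : ∀ c z ks → admissibleByZeros c (suc z) (zero ∷ ks) ≡ admissibleByZeros c z ks
admissibleByZeros-zero∷ c z ks = cong₂ (λ b b′ → (content ks ≡ᵇ c) ∧ (b ∧ b′))
  (cong (_≡ᵇ suc (length ks)) (ℕP.+-suc (support ks) z)) (noAdjPos-zero∷ ks)

admissibleByZeros-suc∷ : ∀ c z j ks → admissibleByZeros c z (suc j ∷ ks) ≡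
  (suc j + content ks ≡ᵇ c) ∧ ((support ks + z ≡ᵇ length ks) ∧ noAdjPos (1 ∷ ks))
admissibleByZeros-suc∷ c z j ks =
  cong (λ b → (suc j + content ks ≡ᵇ c) ∧ ((support ks + z ≡ᵇ length ks) ∧ b)) (noAdjPos-suc∷ j ks)

admissibleByZeros-adjacent : ∀ c z i j ks → admissibleByZeros c z (suc i ∷ suc j ∷ ks) ≡ false
admissibleByZeros-adjacent c z i j ks = trans (cong (A ∧_) (∧-zeroʳ B)) (∧-zeroʳ A)
  where
  A = content (suc i ∷ suc j ∷ ks) ≡ᵇ c
  B = support (suc i ∷ suc j ∷ ks) + z ≡ᵇ length (suc i ∷ suc j ∷ ks)

*-if : ∀ a b x → a ℚ.* (if b then x else 0ℚ) ≡ (if b then a ℚ.* x else 0ℚ)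
*-if a true  x = refl
*-if a false x = ℚP.*-zeroʳ a

atRemainder-≡ᵇ : ∀ n k s (B : Bool) (x : ℚ) →
  atRemainder n k (λ i → if (s ≡ᵇ i) ∧ B then x else 0ℚ) ≡ (if (k + s ≡ᵇ n) ∧ B then x else 0ℚ)
atRemainder-≡ᵇ n       zero    s B x = refl
atRemainder-≡ᵇ zero    (suc k) s B x = refl
atRemainder-≡ᵇ (suc n) (suc k) s B x = atRemainder-≡ᵇ n k s B x

-- The tuple is read from the left, c and z being the content and the number of zeros still
-- to be consumed; weight⁺ is the state just after a positive entry, where another one is forbidden.
mutual
  weight : ℕ → ℕ → List ℕ → ℚ
  weight c z []           = δ c z
  weight c z (zero  ∷ ks) = atRemainder z 1 (λ z′ → weight c z′ ks)
  weight c z (suc j ∷ ks) = 1/[1+ suc j ]! ℚ.* atRemainder c (suc j) (λ c′ → weight⁺ c′ z ks)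

  weight⁺ : ℕ → ℕ → List ℕ → ℚ
  weight⁺ c z (suc _ ∷ _) = 0ℚ
  weight⁺ c z ks          = weight c z ks

mutual
  weight-spec : ∀ c z ks → weight c z ks ≡ (if admissibleByZeros c z ks then 1/prodFact ks else 0ℚ)
  weight-spec zero    zero    []           = refl
  weight-spec zero    (suc z) []           = refl
  weight-spec (suc c) zero    []           = refl
  weight-spec (suc c) (suc z) []           = refl
  weight-spec c       zero    (zero ∷ ks)  =
    cong (λ b → if b then 1/prodFact (zero ∷ ks) else 0ℚ) (sym (admissibleByZeros-zero∷-none c ks))
  weight-spec c       (suc z) (zero ∷ ks)  = trans (weight-spec c z ks)
    (cong₂ (λ b x → if b then x else 0ℚ) (sym (admissibleByZeros-zero∷ c z ks))
                                          (sym (ℚP.*-identityˡ (1/prodFact ks))))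
  weight-spec c       z       (suc j ∷ ks) = begin
    1/[1+ suc j ]! ℚ.* atRemainder c (suc j) (λ c′ → weight⁺ c′ z ks)
      ≡⟨ cong (1/[1+ suc j ]! ℚ.*_) (atRemainder-cong c (suc j) (λ c′ _ → weight⁺-spec c′ z ks)) ⟩
    1/[1+ suc j ]! ℚ.* atRemainder c (suc j) (λ c′ → if (content ks ≡ᵇ c′) ∧ R then 1/prodFact ks else 0ℚ)
      ≡⟨ cong (1/[1+ suc j ]! ℚ.*_) (atRemainder-≡ᵇ c (suc j) (content ks) R (1/prodFact ks)) ⟩
    1/[1+ suc j ]! ℚ.* (if (suc j + content ks ≡ᵇ c) ∧ R then 1/prodFact ks else 0ℚ)
      ≡⟨ *-if 1/[1+ suc j ]! _ (1/prodFact ks) ⟩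
    (if (suc j + content ks ≡ᵇ c) ∧ R then 1/prodFact (suc j ∷ ks) else 0ℚ)
      ≡⟨ cong (λ b → if b then 1/prodFact (suc j ∷ ks) else 0ℚ) (admissibleByZeros-suc∷ c z j ks) ⟨
    (if admissibleByZeros c z (suc j ∷ ks) then 1/prodFact (suc j ∷ ks) else 0ℚ) ∎
    where
    open ≡-Reasoning
    R = (support ks + z ≡ᵇ length ks) ∧ noAdjPos (1 ∷ ks)

  weight⁺-spec : ∀ c z ks →
    weight⁺ c z ks ≡ (if admissibleByZeros (suc c) z (1 ∷ ks) then 1/prodFact ks else 0ℚ)
  weight⁺-spec c z []           = weight-spec c z []
  weight⁺-spec c z (zero  ∷ ks) = weight-spec c z (zero ∷ ks)
  weight⁺-spec c z (suc k ∷ ks) =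
    cong (λ b → if b then 1/prodFact (suc k ∷ ks) else 0ℚ) (sym (admissibleByZeros-adjacent (suc c) z 0 k ks))

∑-tuples-suc : ∀ m b (f : List ℕ → ℚ) →
  ∑[ ks ∈ tuples (suc m) b ] f ks ≡
  ∑[ ks ∈ tuples m b ] f (zero ∷ ks) ℚ.+ ∑[ j ∈ upTo b ] ∑[ ks ∈ tuples m b ] f (suc j ∷ ks)
∑-tuples-suc m b f = begin
  ∑[ ks ∈ concatMap (λ k → map (k ∷_) (tuples m b)) (upTo (suc b)) ] f ks
    ≡⟨ ∑-concatMap (upTo (suc b)) (λ k → map (k ∷_) (tuples m b)) f ⟩
  ∑[ k ∈ upTo (suc b) ] ∑[ ks ∈ map (k ∷_) (tuples m b) ] f ks
    ≡⟨ ∑-cong (upTo (suc b)) (λ k → ∑-map (tuples m b) (k ∷_) f) ⟩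
  ∑[ k ∈ upTo (suc b) ] ∑[ ks ∈ tuples m b ] f (k ∷ ks)
    ≡⟨ ∑-upTo-suc b (λ k → ∑[ ks ∈ tuples m b ] f (k ∷ ks)) ⟩
  ∑[ ks ∈ tuples m b ] f (zero ∷ ks) ℚ.+ ∑[ j ∈ upTo b ] ∑[ ks ∈ tuples m b ] f (suc j ∷ ks) ∎
  where open ≡-Reasoning

remainder< : ∀ {i k n} → i + suc k ≡ n → i < n
remainder< {i} i+1+k≡n = subst (i <_) i+1+k≡n (ℕP.m<m+n i (s≤s z≤n))

module TupleSums (b : ℕ) where

  weightSum weightSum⁺ : ℕ → ℕ → ℕ → ℚ
  weightSum  m c z = ∑[ ks ∈ tuples m b ] weight c z ks
  weightSum⁺ m c z = ∑[ ks ∈ tuples m b ] weight⁺ c z ks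

  weightTotal weightTotal⁺ : ℕ → ℕ → ℕ → ℚ
  weightTotal  M c z = ∑[ m ∈ upTo M ] weightSum m c z
  weightTotal⁺ M c z = ∑[ m ∈ upTo M ] weightSum⁺ m c z

  headPositive : ℕ → (ℕ → ℚ) → ℚ
  headPositive c F = ∑[ j ∈ upTo b ] (1/[1+ suc j ]! ℚ.* atRemainder c (suc j) F)

  startsWithZero : ∀ m c z →
    ∑[ ks ∈ tuples m b ] weight c z (zero ∷ ks) ≡ atRemainder z 1 (λ z′ → weightSum m c z′)
  startsWithZero m c z = ∑-atRemainder (tuples m b) z 1 (λ z′ ks → weight c z′ ks)

  startsPositive : ∀ m c z j → ∑[ ks ∈ tuples m b ] weight c z (suc j ∷ ks) ≡
                               1/[1+ suc j ]! ℚ.* atRemainder c (suc j) (λ c′ → weightSum⁺ m c′ z)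
  startsPositive m c z j = trans (∑-*ˡ (tuples m b) 1/[1+ suc j ]! _)
    (cong (1/[1+ suc j ]! ℚ.*_) (∑-atRemainder (tuples m b) c (suc j) (λ c′ ks → weight⁺ c′ z ks)))

  weightSum⁺-suc : ∀ m c z → weightSum⁺ (suc m) c z ≡ atRemainder z 1 (λ z′ → weightSum m c z′)
  weightSum⁺-suc m c z = begin
    weightSum⁺ (suc m) c z
      ≡⟨ ∑-tuples-suc m b (weight⁺ c z) ⟩
    ∑[ ks ∈ tuples m b ] weight c z (zero ∷ ks) ℚ.+ ∑[ j ∈ upTo b ] ∑[ ks ∈ tuples m b ] 0ℚ
      ≡⟨ cong₂ ℚ._+_ (startsWithZero m c z)
                      (trans (∑-cong (upTo b) (λ _ → ∑-zero (tuples m b))) (∑-zero (upTo b))) ⟩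
    atRemainder z 1 (λ z′ → weightSum m c z′) ℚ.+ 0ℚ
      ≡⟨ ℚP.+-identityʳ _ ⟩
    atRemainder z 1 (λ z′ → weightSum m c z′) ∎
    where open ≡-Reasoning

  weightSum-suc : ∀ m c z →
    weightSum (suc m) c z ≡ weightSum⁺ (suc m) c z ℚ.+ headPositive c (λ c′ → weightSum⁺ m c′ z)
  weightSum-suc m c z = trans (∑-tuples-suc m b (weight c z))
    (cong₂ ℚ._+_ (trans (startsWithZero m c z) (sym (weightSum⁺-suc m c z)))
                  (∑-cong (upTo b) (startsPositive m c z)))

  weightTotal⁺-suc : ∀ M c z →
    weightTotal⁺ (suc M) c z ≡ δ c z ℚ.+ atRemainder z 1 (λ z′ → weightTotal M c z′)
  weightTotal⁺-suc M c z = begin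
    weightTotal⁺ (suc M) c z
      ≡⟨ ∑-upTo-suc M (λ m → weightSum⁺ m c z) ⟩
    (δ c z ℚ.+ 0ℚ) ℚ.+ ∑[ m ∈ upTo M ] weightSum⁺ (suc m) c z
      ≡⟨ cong₂ ℚ._+_ (ℚP.+-identityʳ (δ c z)) (∑-cong (upTo M) (λ m → weightSum⁺-suc m c z)) ⟩
    δ c z ℚ.+ ∑[ m ∈ upTo M ] atRemainder z 1 (λ z′ → weightSum m c z′)
      ≡⟨ cong (δ c z ℚ.+_) (∑-atRemainder (upTo M) z 1 (λ z′ m → weightSum m c z′)) ⟩
    δ c z ℚ.+ atRemainder z 1 (λ z′ → weightTotal M c z′) ∎
    where open ≡-Reasoning

  ∑-headPositive : ∀ M c (F : ℕ → ℕ → ℚ) →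
    ∑[ m ∈ upTo M ] headPositive c (F m) ≡ headPositive c (λ c′ → ∑[ m ∈ upTo M ] F m c′)
  ∑-headPositive M c F = trans (∑-comm (upTo M) (upTo b) _) (∑-cong (upTo b) (λ j →
    trans (∑-*ˡ (upTo M) 1/[1+ suc j ]! _)
          (cong (1/[1+ suc j ]! ℚ.*_) (∑-atRemainder (upTo M) c (suc j) (λ c′ m → F m c′)))))

  weightTotal-suc : ∀ M c z →
    weightTotal (suc M) c z ≡ weightTotal⁺ (suc M) c z ℚ.+ headPositive c (λ c′ → weightTotal⁺ M c′ z)
  weightTotal-suc M c z = begin
    weightTotal (suc M) c z
      ≡⟨ ∑-upTo-suc M (λ m → weightSum m c z) ⟩
    weightSum 0 c z ℚ.+ ∑[ m ∈ upTo M ] weightSum (suc m) c z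
      ≡⟨ cong (weightSum 0 c z ℚ.+_) (trans (∑-cong (upTo M) (λ m → weightSum-suc m c z))
                                            (∑-+ (upTo M) (λ m → weightSum⁺ (suc m) c z) _)) ⟩
    weightSum⁺ 0 c z ℚ.+ (∑[ m ∈ upTo M ] weightSum⁺ (suc m) c z ℚ.+ ∑[ m ∈ upTo M ] positive m)
      ≡⟨ ℚP.+-assoc (weightSum⁺ 0 c z) _ _ ⟨
    (weightSum⁺ 0 c z ℚ.+ ∑[ m ∈ upTo M ] weightSum⁺ (suc m) c z) ℚ.+ ∑[ m ∈ upTo M ] positive m
      ≡⟨ cong₂ ℚ._+_ (sym (∑-upTo-suc M (λ m → weightSum⁺ m c z)))
                      (∑-headPositive M c (λ m c′ → weightSum⁺ m c′ z)) ⟩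
    weightTotal⁺ (suc M) c z ℚ.+ headPositive c (λ c′ → weightTotal⁺ M c′ z) ∎
    where
    open ≡-Reasoning
    positive : ℕ → ℚ
    positive m = headPositive c (λ c′ → weightSum⁺ m c′ z)

  -- An admissible tuple with content c and z zeros has length at most c + z, so the totals
  -- no longer change once M > c + z.
  weightTotal-stable : ∀ M c z → c ≤ b → c + z < M →
                       weightTotal M c z ≡ expCoeff z c × weightTotal⁺ M c z ≡ expCoeff⁺ z c
  weightTotal-stable (suc M) c z c≤b c+z<1+M = total , total⁺
    where
    open ≡-Reasoning
    c+z≤M : c + z ≤ M
    c+z≤M = ℕP.≤-pred c+z<1+M
    zeros : atRemainder z 1 (λ z′ → weightTotal M c z′) ≡ atRemainder z 1 (λ z′ → expCoeff z′ c)
    zeros = atRemainder-cong z 1 (λ z′ z′+1≡z →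
      proj₁ (weightTotal-stable M c z′ c≤b (ℕP.<-≤-trans (ℕP.+-monoʳ-< c (remainder< z′+1≡z)) c+z≤M)))
    total⁺ : weightTotal⁺ (suc M) c z ≡ expCoeff⁺ z c
    total⁺ = trans (weightTotal⁺-suc M c z) (cong (δ c z ℚ.+_) zeros)
    smaller : ∀ j → atRemainder c (suc j) (λ c′ → weightTotal⁺ M c′ z) ≡ atRemainder c (suc j) (expCoeff⁺ z)
    smaller j = atRemainder-cong c (suc j) (λ c′ c′+1+j≡c →
      proj₂ (weightTotal-stable M c′ z (ℕP.≤-trans (ℕP.<⇒≤ (remainder< c′+1+j≡c)) c≤b)
                                       (ℕP.<-≤-trans (ℕP.+-monoˡ-< z (remainder< c′+1+j≡c)) c+z≤M)))
    total : weightTotal (suc M) c z ≡ expCoeff z c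
    total = begin
      weightTotal (suc M) c z
        ≡⟨ weightTotal-suc M c z ⟩
      weightTotal⁺ (suc M) c z ℚ.+ headPositive c (λ c′ → weightTotal⁺ M c′ z)
        ≡⟨ cong₂ ℚ._+_ total⁺ (∑-cong (upTo b) (λ j → cong (1/[1+ suc j ]! ℚ.*_) (smaller j))) ⟩
      expCoeff⁺ z c ℚ.+ headPositive c (expCoeff⁺ z)
        ≡⟨ cong₂ ℚ._+_ (ℚP.*-identityˡ (expCoeff⁺ z c))
                        (∑-cong (upTo b) (λ j → atRemainder-*ˡ c (suc j) 1/[1+ suc j ]! (expCoeff⁺ z))) ⟨
      1/[1+ 0 ]! ℚ.* expCoeff⁺ z c
        ℚ.+ ∑[ j ∈ upTo b ] atRemainder c (suc j) (λ i → 1/[1+ suc j ]! ℚ.* expCoeff⁺ z i)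
        ≡⟨ atRemainder-sum≈antidiagonal c b (λ i k → 1/[1+ k ]! ℚ.* expCoeff⁺ z i) c≤b ⟩
      antidiagonal c (λ i k → 1/[1+ k ]! ℚ.* expCoeff⁺ z i)
        ≡⟨ expCoeff-convolution z c ⟩
      expCoeff z c ∎

admissible-term : ∀ z ℓ ks →
  (if admissible (suc z + ℓ) ℓ ks then term (suc z + ℓ) ks else 0ℚ) ≡ (suc z + ℓ) ! ÷ 1 ℚ.* weight ℓ z ks
admissible-term z ℓ ks = begin
  (if admissible p ℓ ks then term p ks else 0ℚ)
    ≡⟨ cong₂ (λ b x → if b then x else 0ℚ) (admissible≡admissibleByZeros z ℓ ks) (term≡ p ks) ⟩
  (if admissibleByZeros ℓ z ks then p ! ÷ 1 ℚ.* 1/prodFact ks else 0ℚ)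
    ≡⟨ *-if (p ! ÷ 1) (admissibleByZeros ℓ z ks) (1/prodFact ks) ⟨
  p ! ÷ 1 ℚ.* (if admissibleByZeros ℓ z ks then 1/prodFact ks else 0ℚ)
    ≡⟨ cong (p ! ÷ 1 ℚ.*_) (weight-spec ℓ z ks) ⟨
  p ! ÷ 1 ℚ.* weight ℓ z ks ∎
  where
  open ≡-Reasoning
  p = suc z + ℓ

factorial-*-expCoeff : ∀ z ℓ → (suc z + ℓ) ! ÷ 1 ℚ.* expCoeff z ℓ ≡ surj (suc z + ℓ) (suc z) ÷ 1
factorial-*-expCoeff z ℓ = trans (÷!-*-÷! (p !) (surj p (suc z)) 0 p)
  (÷-cross (1 * (p ! * surj p (suc z))) (p !) (surj p (suc z)) 1 {{p !≢0}} (cancel (p !) (surj p (suc z))))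
  where
  p = suc z + ℓ
  cancel : ∀ f s → 1 * (f * s) * 1 ≡ s * f
  cancel = solve-∀

c≡surj : ∀ z ℓ → c (suc z + ℓ) ℓ ≡ surj (suc z + ℓ) (suc z) ÷ 1
c≡surj z ℓ = begin
  c p ℓ
    ≡⟨ ∑-filter (candidates p ℓ) (admissible p ℓ) (term p) ⟩
  ∑[ ks ∈ candidates p ℓ ] (if admissible p ℓ ks then term p ks else 0ℚ)
    ≡⟨ ∑-cong (candidates p ℓ) (admissible-term z ℓ) ⟩
  ∑[ ks ∈ candidates p ℓ ] (p ! ÷ 1 ℚ.* weight ℓ z ks)
    ≡⟨ ∑-*ˡ (candidates p ℓ) (p ! ÷ 1) (weight ℓ z) ⟩
  p ! ÷ 1 ℚ.* ∑[ ks ∈ candidates p ℓ ] weight ℓ z ks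
    ≡⟨ cong (p ! ÷ 1 ℚ.*_) (∑-concatMap (upTo (suc p)) (λ m → tuples m ℓ) (weight ℓ z)) ⟩
  p ! ÷ 1 ℚ.* TupleSums.weightTotal ℓ (suc p) ℓ z
    ≡⟨ cong (p ! ÷ 1 ℚ.*_) (proj₁ (TupleSums.weightTotal-stable ℓ (suc p) ℓ z ℕP.≤-refl ℓ+z<1+p)) ⟩
  p ! ÷ 1 ℚ.* expCoeff z ℓ
    ≡⟨ factorial-*-expCoeff z ℓ ⟩
  surj p (suc z) ÷ 1 ∎
  where
  open ≡-Reasoning
  p = suc z + ℓ
  ℓ+z<1+p : ℓ + z < suc p
  ℓ+z<1+p = s≤s (ℕP.≤-trans (ℕP.≤-reflexive (ℕP.+-comm ℓ z)) (ℕP.n≤1+n (z + ℓ)))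

mainTheorem2 : (p ℓ : ℕ) → 1 ≤ p → ℓ < p →
    c p ℓ ≡ (+ ((p ∸ ℓ) ! * S p (p ∸ ℓ))) / 1
mainTheorem2 p ℓ _ ℓ<p = subst (λ q → c q ℓ ≡ surj q (q ∸ ℓ) ÷ 1) 1+z+ℓ≡p (begin
  c (suc z + ℓ) ℓ
    ≡⟨ c≡surj z ℓ ⟩
  surj (suc z + ℓ) (suc z) ÷ 1
    ≡⟨ cong (λ n → surj (suc z + ℓ) n ÷ 1) (ℕP.m+n∸n≡m (suc z) ℓ) ⟨
  surj (suc z + ℓ) (suc z + ℓ ∸ ℓ) ÷ 1 ∎)
  where
  open ≡-Reasoning
  z = p ∸ suc ℓ
  1+z+ℓ≡p : suc z + ℓ ≡ p
  1+z+ℓ≡p = trans (sym (ℕP.+-suc z ℓ)) (ℕP.m∸n+n≡m ℓ<p)
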